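{- Let $G$ be a subcubic graph, $\pi=\{V_1,\dots,V_k\}$ a connected coalition partition of $G$, and $H=CCG(G,\pi)$. Then $H$ contains none of the following graphs as a subgraph: (i) $K_2\cup K_3$; (ii) $K_2\cup S_4$; (iii) $2C_3+e$.
   Context: Graphs are finite and simple. A graph is subcubic if it is connected and its maximum vertex degree is at most 3. $G[S]$ is the induced subgraph. A set $D\subseteq V$ is dominating if every vertex of $V\setminus D$ has a neighbour in $D$; connected dominating if moreover $G[D]$ is connected. Two disjoint subsets $A,B\subseteq V$ form a connected coalition if neither is a connected dominating set but $A\cup B$ is. A connected coalition partition of $G$ is a partition $\pi=\{V_1,\dots,V_k\}$ of $V$ such that each $V_i$ either is a connected dominating set consisting of a single vertex or forms a connected coalition with some set of $\pi$. The coalition graph $CCG(G,\pi)$ has vertex set $\{V_1,\dots,V_k\}$, with $V_i\sim V_j$ iff they form a connected coalition. $K_2\cup K_3$ and $K_2\cup S_4$ denote disjoint unions, where $S_4=K_{1,3}$. $2C_3+e$ is the graph obtained from $K_4-e$ by identifying one of its vertices of degree 3 with an end vertex of a $K_2$ (i.e. $K_4-e$ with a pendant vertex attached to a vertex of degree 3); it has 5 vertices and 6 edges. -}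

module Defs where

open import Data.Nat using (ℕ; _≤_)
open import Data.Fin using (Fin; zero; suc)
open import Data.Bool using (Bool; true; false; if_then_else_)
open import Data.List using (List; []; _∷_; map; allFin)
open import Data.Nat.ListAction using (sum)
open import Data.List.Membership.Propositional using (_∈_)
open import Data.Product using (Σ; ∃; _×_; _,_)
open import Data.Sum using (_⊎_)
open import Data.Unit using (⊤)
open import Function.Definitions using (Injective)
open import Relation.Nullary using (¬_)
open import Relation.Binary.PropositionalEquality using (_≡_; _≢_)

record Graph (n : ℕ) : Set where
  field
    adj    : Fin n → Fin n → Bool
    sym    : ∀ u v → adj u v ≡ adj v u
    irrefl : ∀ v → adj v v ≡ false

  Adj : Fin n → Fin n → Set
  Adj u v = adj u v ≡ true

  degree : Fin n → ℕ
  degree v = sum (map (λ w → if adj v w then 1 else 0) (allFin n))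

open Graph public

VSet : ℕ → Set₁
VSet n = Fin n → Set

_∪_ : ∀ {n} → VSet n → VSet n → VSet n
(A ∪ B) v = A v ⊎ B v

data Walk {n} (G : Graph n) (S : VSet n) : Fin n → Fin n → Set where
  here : ∀ {v} → S v → Walk G S v v
  step : ∀ {u w v} → S u → Adj G u w → Walk G S w v → Walk G S u v

InducedConnected : ∀ {n} → Graph n → VSet n → Set
InducedConnected G S = (∃ λ v → S v) × (∀ u v → S u → S v → Walk G S u v)

Connected : ∀ {n} → Graph n → Set
Connected G = InducedConnected G (λ _ → ⊤)

Subcubic : ∀ {n} → Graph n → Set
Subcubic {n} G = Connected G × (∀ v → degree G v ≤ 3)

Dominating : ∀ {n} → Graph n → VSet n → Set
Dominating G D = ∀ v → ¬ D v → ∃ λ u → D u × Adj G v u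

ConnectedDominating : ∀ {n} → Graph n → VSet n → Set
ConnectedDominating G D = Dominating G D × InducedConnected G D

ConnectedCoalition : ∀ {n} → Graph n → VSet n → VSet n → Set
ConnectedCoalition G A B =
  ¬ ConnectedDominating G A × ¬ ConnectedDominating G B × ConnectedDominating G (A ∪ B)

record Partition (n k : ℕ) : Set where
  field
    label    : Fin n → Fin k
    nonempty : ∀ i → ∃ λ v → label v ≡ i

  part : Fin k → VSet n
  part i v = label v ≡ i

open Partition public

SingletonPart : ∀ {n k} → Partition n k → Fin k → Set
SingletonPart π i = ∃ λ v → ∀ w → (part π i w → w ≡ v) × (w ≡ v → part π i w)

CCGAdj : ∀ {n k} → Graph n → Partition n k → Fin k → Fin k → Set
CCGAdj G π i j = i ≢ j × ConnectedCoalition G (part π i) (part π j)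

IsConnectedCoalitionPartition : ∀ {n k} → Graph n → Partition n k → Set
IsConnectedCoalitionPartition G π =
  ∀ i → (ConnectedDominating G (part π i) × SingletonPart π i)
        ⊎ (∃ λ j → CCGAdj G π i j)

record Pattern : Set where
  field
    size  : ℕ
    edges : List (Fin size × Fin size)

open Pattern public

ContainsSubgraph : ∀ {k} → (Fin k → Fin k → Set) → Pattern → Set
ContainsSubgraph {k} H P =
  Σ (Fin (size P) → Fin k) λ φ →
    Injective _≡_ _≡_ φ × (∀ a b → (a , b) ∈ edges P → H (φ a) (φ b))

K2∪K3 : Pattern
K2∪K3 = record { size = 5 ; edges =
  (0F , 1F) ∷ (2F , 3F) ∷ (3F , 4F) ∷ (2F , 4F) ∷ [] }
  where
  0F 1F 2F 3F 4F : Fin 5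
  0F = zero
  1F = suc zero
  2F = suc (suc zero)
  3F = suc (suc (suc zero))
  4F = suc (suc (suc (suc zero)))

K2∪S4 : Pattern
K2∪S4 = record { size = 6 ; edges =
  (0F , 1F) ∷ (2F , 3F) ∷ (2F , 4F) ∷ (2F , 5F) ∷ [] }
  where
  0F 1F 2F 3F 4F 5F : Fin 6
  0F = zero
  1F = suc zero
  2F = suc (suc zero)
  3F = suc (suc (suc zero))
  4F = suc (suc (suc (suc zero)))
  5F = suc (suc (suc (suc (suc zero))))

-- 2C₃+e : K₄ - e on {0,1,2,3} (missing edge 2-3; 0,1 of degree 3)
-- with pendant vertex 4 attached to 0
2C3+e : Pattern
2C3+e = record { size = 5 ; edges =
  (0F , 1F) ∷ (0F , 2F) ∷ (0F , 3F) ∷ (1F , 2F) ∷ (1F , 3F) ∷ (0F , 4F) ∷ [] }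
  where
  0F 1F 2F 3F 4F : Fin 5
  0F = zero
  1F = suc zero
  2F = suc (suc zero)
  3F = suc (suc (suc zero))
  4F = suc (suc (suc (suc zero)))

{-# OPTIONS --safe #-}
module Submission where

-- Each coalition V_i ∪ V_j is a connected dominating set with at least two vertices, so every
-- vertex has a neighbour in it; as degrees are at most 3, no vertex has neighbours in four
-- pairwise disjoint sets.  In each configuration this forces a part X lying in a coalition to
-- be a connected dominating set itself, which is absurd.  Parts are numbered by the vertices of
-- the pattern graph.
--
-- K₂ ∪ S₄, X = V₂ the centre of the star: every vertex has a neighbour in V₂ and one in V₀ ∪ V₁,
-- so G[V₂] has maximum degree 2, and a V₂-vertex with a neighbour in a star leaf V₃, V₄, V₅ is
-- a leaf of G[V₂].  If a walk in V₂ ∪ V_j between two V₂-vertices had to leave V₂ for each of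
-- j = 3, 4, 5, the component of G[V₂] containing them would be a path or cycle with three leaves.
--
-- 2C₃+e, X = V₀ the vertex of degree 4: every vertex has a neighbour in V₀, so G[V₁ ∪ V₂] and
-- G[V₁ ∪ V₃] are connected of maximum degree 2, and a vertex with two neighbours outside one of
-- them is a leaf of it.  G[V₁ ∪ V₂] has leaves next to V₃ and next to V₄, G[V₁ ∪ V₃] one next
-- to V₄.  A V₂-path between distinct vertices of V₀ would create a third leaf in one of them, or
-- a triangle in G[V₁ ∪ V₂] forming a whole component; so walks in V₀ ∪ V₂ between V₀-vertices
-- can be rerouted inside V₀.
--
-- K₂ ∪ K₃, X a triangle part: every vertex has neighbours in two triangle parts, hence only one
-- in V₀ ∪ V₁, which is therefore a single edge xy, and every vertex is adjacent to x or y.  If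
-- x and y have neighbours x′ and y′ in X, then at most two vertices lie outside
-- V₀ ∪ V₁ ∪ {x′, y′}, which leaves room only for X = {x′, y′} with x′y′ an edge.

open import Defs renaming (sym to adj-sym)
open import Data.Nat using (ℕ; zero; suc; _≤_; _<_; z≤n; s≤s)
open import Data.Nat.Properties using (≤-trans; ≤-refl; ≤-pred; ≤-<-trans; <⇒≤; m≤n⇒m≤1+n; ≤⇒≯)
open import Data.Fin using (Fin; zero; suc)
open import Data.Fin.Properties using (_≟_)
open import Data.Fin.Patterns using (0F; 1F; 2F; 3F; 4F; 5F)
open import Data.Fin.Subset using (Subset; _-_; ∣_∣) renaming (_∈_ to _∈ˢ_)
open import Data.Fin.Subset.Properties using (x∈p⇒∣p-x∣<∣p∣; x∈p∧x≢y⇒x∈p-y)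
open import Data.Bool using (Bool; true; false; if_then_else_)
import Data.Bool.Properties as Bool
import Data.List as List
import Data.Vec as Vec
open import Data.List.Properties using (map-tabulate)
open import Data.List.Membership.Propositional using (_∈_)
open import Data.List.Relation.Unary.Any using (here; there)
open import Data.Vec.Properties using (lookup⇒[]=; lookup∘tabulate)
open import Data.Nat.ListAction using (sum)
open import Data.Product using (Σ-syntax; ∃; ∃₂; _×_; _,_; proj₁; proj₂)
open import Data.Sum using (_⊎_; inj₁; inj₂; [_,_]′; swap)
open import Data.Empty using (⊥; ⊥-elim)
open import Function using (_∘_; id)
open import Function.Definitions using (Injective)
open import Relation.Nullary using (¬_; yes; no)
open import Relation.Unary using (Decidable)
open import Relation.Unary.Properties using (_∪?_)
open import Relation.Binary.PropositionalEquality
  using (_≡_; _≢_; refl; sym; trans; cong; subst; ≢-sym; module ≡-Reasoning)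

m≤∣p-x∣⇒m<∣p∣ : ∀ {n m x} {p : Subset n} → x ∈ˢ p → m ≤ ∣ p - x ∣ → m < ∣ p ∣
m≤∣p-x∣⇒m<∣p∣ x∈p m≤ = ≤-<-trans m≤ (x∈p⇒∣p-x∣<∣p∣ x∈p)

four-elements⇒4≤∣p∣ : ∀ {n a b c d} {p : Subset n} →
  a ∈ˢ p → b ∈ˢ p → c ∈ˢ p → d ∈ˢ p →
  a ≢ b → a ≢ c → a ≢ d → b ≢ c → b ≢ d → c ≢ d → 4 ≤ ∣ p ∣
four-elements⇒4≤∣p∣ a∈ b∈ c∈ d∈ a≢b a≢c a≢d b≢c b≢d c≢d =
  m≤∣p-x∣⇒m<∣p∣ a∈ (m≤∣p-x∣⇒m<∣p∣ b∈p-a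
    (m≤∣p-x∣⇒m<∣p∣ c∈p-a-b (m≤∣p-x∣⇒m<∣p∣ d∈p-a-b-c z≤n)))
  where
  b∈p-a     = x∈p∧x≢y⇒x∈p-y b∈ (≢-sym a≢b)
  c∈p-a-b   = x∈p∧x≢y⇒x∈p-y (x∈p∧x≢y⇒x∈p-y c∈ (≢-sym a≢c)) (≢-sym b≢c)
  d∈p-a-b-c = x∈p∧x≢y⇒x∈p-y (x∈p∧x≢y⇒x∈p-y (x∈p∧x≢y⇒x∈p-y d∈ (≢-sym a≢d)) (≢-sym b≢d))
                (≢-sym c≢d)

sum-indicators≡∣tabulate∣ : ∀ {m} (f : Fin m → Bool) →
  sum (List.tabulate (λ i → if f i then 1 else 0)) ≡ ∣ Vec.tabulate f ∣
sum-indicators≡∣tabulate∣ {zero} f = refl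
sum-indicators≡∣tabulate∣ {suc m} f with f zero
... | true  = cong suc (sum-indicators≡∣tabulate∣ (f ∘ suc))
... | false = sum-indicators≡∣tabulate∣ (f ∘ suc)

∉⇒≢ : ∀ {n} {S : VSet n} {x y} → ¬ S x → S y → x ≢ y
∉⇒≢ x∉S y∈S refl = x∉S y∈S

module Graphs {n : ℕ} (G : Graph n) where

  Adj-sym : ∀ {u v} → Adj G u v → Adj G v u
  Adj-sym {u} {v} u~v = trans (adj-sym G v u) u~v

  Adj⇒≢ : ∀ {u v} → Adj G u v → u ≢ v
  Adj⇒≢ {u} u~u refl with trans (sym u~u) (irrefl G u)
  ... | ()

  NeighbourIn : VSet n → VSet n
  NeighbourIn S v = ∃ λ u → S u × Adj G v u

  neighbourIn-∪ : ∀ {S T v} → NeighbourIn (S ∪ T) v → NeighbourIn S v ⊎ NeighbourIn T v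
  neighbourIn-∪ (u , inj₁ u∈S , v~u) = inj₁ (u , u∈S , v~u)
  neighbourIn-∪ (u , inj₂ u∈T , v~u) = inj₂ (u , u∈T , v~u)

  neighbourhood : Fin n → Subset n
  neighbourhood v = Vec.tabulate (adj G v)

  Adj⇒∈neighbourhood : ∀ {v w} → Adj G v w → w ∈ˢ neighbourhood v
  Adj⇒∈neighbourhood {v} {w} v~w = lookup⇒[]= w _ (trans (lookup∘tabulate (adj G v) w) v~w)

  degree≡∣neighbourhood∣ : ∀ v → degree G v ≡ ∣ neighbourhood v ∣
  degree≡∣neighbourhood∣ v = begin
    degree G v                     ≡⟨ cong sum (map-tabulate {n = n} id indicator) ⟩
    sum (List.tabulate indicator)  ≡⟨ sum-indicators≡∣tabulate∣ (adj G v) ⟩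
    ∣ neighbourhood v ∣            ∎
    where
    open ≡-Reasoning
    indicator : Fin n → ℕ
    indicator w = if adj G v w then 1 else 0

  module _ {S : VSet n} where

    start∈ : ∀ {u v} → Walk G S u v → S u
    start∈ (here s)     = s
    start∈ (step s _ _) = s

    end∈ : ∀ {u v} → Walk G S u v → S v
    end∈ (here s)        = s
    end∈ (step _ _ rest) = end∈ rest

    infixr 5 _◅◅_
    _◅◅_ : ∀ {u v w} → Walk G S u v → Walk G S v w → Walk G S u w
    here _          ◅◅ wk = wk
    step s u~x rest ◅◅ wk = step s u~x (rest ◅◅ wk)

    _▻_ : ∀ {u v w} → Walk G S u v → S w × Adj G v w → Walk G S u w
    wk ▻ (s , v~w) = wk ◅◅ step (end∈ wk) v~w (here s)

    reverse : ∀ {u v} → Walk G S u v → Walk G S v u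
    reverse (here s)          = here s
    reverse (step s u~x rest) = reverse rest ▻ (s , Adj-sym u~x)

    length : ∀ {u v} → Walk G S u v → ℕ
    length (here _)        = 0
    length (step _ _ rest) = suc (length rest)

    first-step : ∀ {u v} → Walk G S u v → u ≢ v → NeighbourIn S u
    first-step (here _)          u≢u = ⊥-elim (u≢u refl)
    first-step (step _ u~x rest) _   = _ , start∈ rest , u~x

    isolated-walk : ∀ {p q} → ¬ NeighbourIn S p → Walk G S p q → q ≡ p
    isolated-walk _      (here _)          = refl
    isolated-walk no-nbr (step _ p~x rest) = ⊥-elim (no-nbr (_ , start∈ rest , p~x))

    Closed : VSet n → Set
    Closed R = ∀ {u w} → R u → S w → Adj G u w → R w

    walk-closed : ∀ {R u v} → Closed R → Walk G S u v → R u → R v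
    walk-closed R-closed (here _)          r = r
    walk-closed R-closed (step _ u~x rest) r =
      walk-closed R-closed rest (R-closed r (start∈ rest) u~x)

  LeafIn : VSet n → Fin n → Set
  LeafIn S p = ∀ {a b} → S a → S b → Adj G p a → Adj G p b → a ≡ b

  MaxDegree2In : VSet n → Set
  MaxDegree2In S = ∀ {v a b c} → S v → S a → S b → S c →
    Adj G v a → Adj G v b → Adj G v c → a ≢ b → a ≢ c → b ≢ c → ⊥

  leaf-edge-component : ∀ {S p q t} → LeafIn S p → LeafIn S q → S q → Adj G p q →
    Walk G S p t → t ≡ p ⊎ t ≡ q
  leaf-edge-component {S} {p} {q} p-leaf q-leaf q∈S p~q wk = walk-closed closed wk (inj₁ refl)
    where
    closed : Closed (λ v → v ≡ p ⊎ v ≡ q)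
    closed (inj₁ refl) w∈S p~w = inj₂ (p-leaf w∈S q∈S p~w p~q)
    closed (inj₂ refl) w∈S q~w = inj₁ (q-leaf w∈S (start∈ wk) q~w (Adj-sym p~q))

  triangle-component : ∀ {S a b c t} → MaxDegree2In S → S a → S b → S c →
    Adj G a b → Adj G b c → Adj G a c → Walk G S a t → t ≡ a ⊎ t ≡ b ⊎ t ≡ c
  triangle-component {S} {a} {b} {c} deg₂ a∈S b∈S c∈S a~b b~c a~c wk =
    walk-closed closed wk (inj₁ refl)
    where
    one-of-two : ∀ {v x y w} → S v → S x → S y → S w → Adj G v x → Adj G v y → x ≢ y →
      Adj G v w → w ≡ x ⊎ w ≡ y
    one-of-two {x = x} {y} {w} v∈S x∈S y∈S w∈S v~x v~y x≢y v~w with w ≟ x | w ≟ y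
    ... | yes w≡x | _       = inj₁ w≡x
    ... | no _    | yes w≡y = inj₂ w≡y
    ... | no w≢x  | no w≢y  =
      ⊥-elim (deg₂ v∈S x∈S y∈S w∈S v~x v~y v~w x≢y (≢-sym w≢x) (≢-sym w≢y))
    closed : Closed (λ v → v ≡ a ⊎ v ≡ b ⊎ v ≡ c)
    closed (inj₁ refl) w∈S a~w =
      inj₂ (one-of-two a∈S b∈S c∈S w∈S a~b a~c (Adj⇒≢ b~c) a~w)
    closed (inj₂ (inj₁ refl)) w∈S b~w =
      [ inj₁ , inj₂ ∘ inj₂ ]′ (one-of-two b∈S a∈S c∈S w∈S (Adj-sym a~b) b~c (Adj⇒≢ a~c) b~w)
    closed (inj₂ (inj₂ refl)) w∈S c~w =
      [ inj₁ , inj₂ ∘ inj₁ ]′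
        (one-of-two c∈S a∈S b∈S w∈S (Adj-sym a~c) (Adj-sym b~c) (Adj⇒≢ a~b) c~w)

  _∖_ : VSet n → Fin n → VSet n
  (S ∖ p) v = S v × v ≢ p

  leaf-∖ : ∀ {S p x} → LeafIn S p → LeafIn (S ∖ x) p
  leaf-∖ p-leaf a b = p-leaf (proj₁ a) (proj₁ b)

  maxDegree2-∖ : ∀ {S x} → MaxDegree2In S → MaxDegree2In (S ∖ x)
  maxDegree2-∖ deg₂ v a b c = deg₂ (proj₁ v) (proj₁ a) (proj₁ b) (proj₁ c)

  module _ {S : VSet n} {p q : Fin n} (p-leaf : LeafIn S p) (q∈S : S q) (p~q : Adj G p q) where

    private
      avoid-leaf : ∀ {x t} (w : Walk G S x t) → x ≢ p → t ≢ p →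
        Σ[ w′ ∈ Walk G (S ∖ p) x t ] length w′ ≤ length w

    bypass-leaf : ∀ {t} (w : Walk G S p t) → t ≢ p →
      Σ[ w′ ∈ Walk G (S ∖ p) q t ] length w′ < length w
    bypass-leaf (here _) t≢p = ⊥-elim (t≢p refl)
    bypass-leaf (step _ p~y rest) t≢p with p-leaf (start∈ rest) q∈S p~y p~q
    ... | refl = let w′ , ≤len = avoid-leaf rest (≢-sym (Adj⇒≢ p~q)) t≢p in w′ , s≤s ≤len

    avoid-leaf (here s) x≢p _ = here (s , x≢p) , z≤n
    avoid-leaf (step {w = y} s x~y rest) x≢p t≢p with y ≟ p
    ... | no y≢p = let w′ , ≤len = avoid-leaf rest y≢p t≢p in step (s , x≢p) x~y w′ , s≤s ≤len
    ... | yes refl with p-leaf s q∈S (Adj-sym x~y) p~q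
    ...   | refl = let w′ , <len = bypass-leaf rest t≢p in w′ , m≤n⇒m≤1+n (<⇒≤ <len)

  private
    -- Induction on the length of the walk p₁ ⇝ p₂: deleting the leaf p₁ turns its neighbour
    -- q into a leaf, unless q is p₂ or p₃, in which case {p₁, q} is a whole component.
    no-three-leaves-within : ∀ m {S p₁ p₂ p₃} → MaxDegree2In S →
      LeafIn S p₁ → LeafIn S p₂ → LeafIn S p₃ → p₁ ≢ p₂ → p₁ ≢ p₃ → p₂ ≢ p₃ →
      (w₁₂ : Walk G S p₁ p₂) → length w₁₂ ≤ m → Walk G S p₁ p₃ → ⊥
    no-three-leaves-within _ _ _ _ _ p₁≢p₂ _ _ (here _) _ _ = p₁≢p₂ refl
    no-three-leaves-within (suc m) {S} {p₁} {p₂} {p₃} deg₂ l₁ l₂ l₃ p₁≢p₂ p₁≢p₃ p₂≢p₃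
                           w₁₂@(step {w = q} _ p₁~q rest) (s≤s len≤m) w₁₃
      with q ≟ p₂ | q ≟ p₃
    ... | yes refl | _ =
      [ p₁≢p₃ ∘ sym , p₂≢p₃ ∘ sym ]′ (leaf-edge-component l₁ l₂ (start∈ rest) p₁~q w₁₃)
    ... | no _ | yes refl =
      [ p₁≢p₂ ∘ sym , p₂≢p₃ ]′ (leaf-edge-component l₁ l₃ (start∈ rest) p₁~q w₁₂)
    ... | no q≢p₂ | no q≢p₃
      with bypass-leaf l₁ (start∈ rest) p₁~q w₁₂ (≢-sym p₁≢p₂)
         | bypass-leaf l₁ (start∈ rest) p₁~q w₁₃ (≢-sym p₁≢p₃)
    ...   | w′₁₂ , <len | w′₁₃ , _ =
      no-three-leaves-within m (maxDegree2-∖ deg₂) q-leaf (leaf-∖ l₂) (leaf-∖ l₃)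
        q≢p₂ q≢p₃ p₂≢p₃ w′₁₂ (≤-pred (≤-trans <len (s≤s len≤m))) w′₁₃
      where
      q-leaf : LeafIn (S ∖ p₁) q
      q-leaf {a} {b} (a∈S , a≢p₁) (b∈S , b≢p₁) q~a q~b with a ≟ b
      ... | yes a≡b = a≡b
      ... | no a≢b  = ⊥-elim (deg₂ (start∈ rest) a∈S b∈S (start∈ w₁₂) q~a q~b (Adj-sym p₁~q)
                                a≢b a≢p₁ b≢p₁)

  no-three-leaves : ∀ {S p₁ p₂ p₃} → MaxDegree2In S →
    LeafIn S p₁ → LeafIn S p₂ → LeafIn S p₃ → p₁ ≢ p₂ → p₁ ≢ p₃ → p₂ ≢ p₃ →
    Walk G S p₁ p₂ → Walk G S p₁ p₃ → ⊥
  no-three-leaves deg₂ l₁ l₂ l₃ p₁≢p₂ p₁≢p₃ p₂≢p₃ w₁₂ =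
    no-three-leaves-within (length w₁₂) deg₂ l₁ l₂ l₃ p₁≢p₂ p₁≢p₃ p₂≢p₃ w₁₂ ≤-refl

  Exit : VSet n → VSet n → Fin n → Set
  Exit A B u = ∃ λ p → Walk G A u p × NeighbourIn B p

  Bridge : VSet n → Fin n → Fin n → Set
  Bridge B x y = ∃₂ λ w w′ → Adj G x w × Walk G B w w′ × Adj G w′ y

  module _ {A B : VSet n} (A? : Decidable A) where

    ∪-other : ∀ {v} → (A ∪ B) v → ¬ A v → B v
    ∪-other (inj₁ a) ¬a = ⊥-elim (¬a a)
    ∪-other (inj₂ b) _  = b

    walk-or-exit : ∀ {u v} → Walk G (A ∪ B) u v → A u → Walk G A u v ⊎ Exit A B u
    walk-or-exit (here _) a = inj₁ (here a)
    walk-or-exit (step {w = x} _ u~x rest) a with A? x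
    ... | no ¬ax = inj₂ (_ , here a , x , ∪-other (start∈ rest) ¬ax , u~x)
    ... | yes ax with walk-or-exit rest ax
    ...   | inj₁ wk             = inj₁ (step a u~x wk)
    ...   | inj₂ (p , wk , nbr) = inj₂ (p , step a u~x wk , nbr)

    crossing-edge : ∀ {u v} → Walk G (A ∪ B) u v → A u → ¬ A v →
      ∃₂ λ p q → A p × B q × Adj G p q
    crossing-edge wk a ¬av with walk-or-exit wk a
    ... | inj₁ wkᴬ                         = ⊥-elim (¬av (end∈ wkᴬ))
    ... | inj₂ (p , wkᴬ , q , q∈B , p~q) = p , q , end∈ wkᴬ , q∈B , p~q

    module _ (join : ∀ {x y} → A x → A y → Bridge B x y → Walk G A x y) where

      private
        -- the walk left A at x through the edge x w and has since stayed in B, up to c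
        excursion : ∀ {x w c v} → A x → Adj G x w → Walk G B w c → Walk G (A ∪ B) c v →
          ¬ A c → A v → Walk G A x v

      bridges-elim : ∀ {u v} → Walk G (A ∪ B) u v → A u → A v → Walk G A u v
      bridges-elim (here _) a _ = here a
      bridges-elim (step {w = x} _ u~x rest) a av with A? x
      ... | yes ax = step a u~x (bridges-elim rest ax av)
      ... | no ¬ax = excursion a u~x (here (∪-other (start∈ rest) ¬ax)) rest ¬ax av

      excursion _  _   _  (here _) ¬ac av = ⊥-elim (¬ac av)
      excursion ax x~w wc (step {w = d} _ c~d rest) _ av with A? d
      ... | yes ad = join ax ad (_ , _ , x~w , wc , c~d) ◅◅ bridges-elim rest ad av
      ... | no ¬ad = excursion ax x~w (wc ▻ (∪-other (start∈ rest) ¬ad , c~d)) rest ¬ad av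

  cds-total : ∀ {D a b} → Decidable D → ConnectedDominating G D → D a → D b → a ≢ b →
    ∀ v → NeighbourIn D v
  cds-total {D} {a} {b} D? (dominating , _ , connected) a∈D b∈D a≢b v with D? v
  ... | no v∉D = dominating v v∉D
  ... | yes v∈D with v ≟ a
  ...   | yes refl = first-step (connected v b v∈D b∈D) a≢b
  ...   | no v≢a   = first-step (connected v a v∈D a∈D) v≢a

module MaxDegree3 {n : ℕ} (G : Graph n) (deg≤3 : ∀ v → degree G v ≤ 3) where

  open Graphs G

  no-four-neighbours : ∀ {v a b c d} → Adj G v a → Adj G v b → Adj G v c → Adj G v d →
    a ≢ b → a ≢ c → a ≢ d → b ≢ c → b ≢ d → c ≢ d → ⊥
  no-four-neighbours {v} v~a v~b v~c v~d a≢b a≢c a≢d b≢c b≢d c≢d =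
    ≤⇒≯ (deg≤3 v) (subst (4 ≤_) (sym (degree≡∣neighbourhood∣ v)) 4≤∣N∣)
    where
    4≤∣N∣ = four-elements⇒4≤∣p∣ (Adj⇒∈neighbourhood v~a) (Adj⇒∈neighbourhood v~b)
              (Adj⇒∈neighbourhood v~c) (Adj⇒∈neighbourhood v~d) a≢b a≢c a≢d b≢c b≢d c≢d

  leaf-if-two-outside : ∀ {S p o₁ o₂} → Adj G p o₁ → Adj G p o₂ → o₁ ≢ o₂ → ¬ S o₁ → ¬ S o₂ →
    LeafIn S p
  leaf-if-two-outside p~o₁ p~o₂ o₁≢o₂ o₁∉S o₂∉S {a} {b} a∈S b∈S p~a p~b with a ≟ b
  ... | yes a≡b = a≡b
  ... | no a≢b  = ⊥-elim (no-four-neighbours p~o₁ p~o₂ p~a p~b o₁≢o₂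
                    (∉⇒≢ o₁∉S a∈S) (∉⇒≢ o₁∉S b∈S) (∉⇒≢ o₂∉S a∈S) (∉⇒≢ o₂∉S b∈S) a≢b)

  maxDegree2-if-neighbour-outside : ∀ {S T} → (∀ {v} → S v → NeighbourIn T v) →
    (∀ {v} → T v → ¬ S v) → MaxDegree2In S
  maxDegree2-if-neighbour-outside T-nbr T-∉-S v∈S a∈S b∈S c∈S v~a v~b v~c a≢b a≢c b≢c
    with T-nbr v∈S
  ... | t , t∈T , v~t = no-four-neighbours v~t v~a v~b v~c
          (∉⇒≢ (T-∉-S t∈T) a∈S) (∉⇒≢ (T-∉-S t∈T) b∈S) (∉⇒≢ (T-∉-S t∈T) c∈S) a≢b a≢c b≢c

module Coalitions {n k : ℕ} (G : Graph n) (π : Partition n k) where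

  open Graphs G

  part? : ∀ i → Decidable (part π i)
  part? i v = label π v ≟ i

  part-apart : ∀ {i j a b} → part π i a → part π j b → i ≢ j → a ≢ b
  part-apart refl refl i≢j refl = i≢j refl

  module _ {i j : Fin k} (coalition : CCGAdj G π i j) where

    coalition-not-cds₁ : ¬ ConnectedDominating G (part π i)
    coalition-not-cds₁ = proj₁ (proj₂ coalition)

    coalition-not-cds₂ : ¬ ConnectedDominating G (part π j)
    coalition-not-cds₂ = proj₁ (proj₂ (proj₂ coalition))

    coalition-walk : ∀ {u v} → (part π i ∪ part π j) u → (part π i ∪ part π j) v →
      Walk G (part π i ∪ part π j) u v
    coalition-walk = proj₂ (proj₂ (proj₂ (proj₂ (proj₂ coalition)))) _ _

    coalition-total : ∀ v → NeighbourIn (part π i ∪ part π j) v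
    coalition-total = cds-total (part? i ∪? part? j) (proj₂ (proj₂ (proj₂ coalition)))
      (inj₁ (proj₂ (nonempty π i))) (inj₂ (proj₂ (nonempty π j)))
      (part-apart (proj₂ (nonempty π i)) (proj₂ (nonempty π j)) (proj₁ coalition))

  module Embedding {m : ℕ} {φ : Fin m → Fin k} (φ-injective : Injective _≡_ _≡_ φ) where

    V : Fin m → VSet n
    V p = part π (φ p)

    V-unique : ∀ {p q a} → V p a → V q a → p ≡ q
    V-unique a∈p a∈q = φ-injective (trans (sym a∈p) a∈q)

    V-∉ : ∀ {p q a} → V p a → p ≢ q → ¬ V q a
    V-∉ a∈p p≢q a∈q = p≢q (V-unique a∈p a∈q)

    V-apart : ∀ {p q a b} → V p a → V q b → p ≢ q → a ≢ b
    V-apart a∈p b∈q p≢q refl = V-∉ a∈p p≢q b∈q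

    V∪-apart : ∀ {p p′ q a b} → (V p ∪ V p′) a → V q b → p ≢ q → p′ ≢ q → a ≢ b
    V∪-apart (inj₁ a∈p)  b∈q p≢q _    = V-apart a∈p b∈q p≢q
    V∪-apart (inj₂ a∈p′) b∈q _   p′≢q = V-apart a∈p′ b∈q p′≢q

    V-apart-∪ : ∀ {p p′ q a b} → V q a → (V p ∪ V p′) b → q ≢ p → q ≢ p′ → a ≢ b
    V-apart-∪ a∈q b∈∪ q≢p q≢p′ = ≢-sym (V∪-apart b∈∪ a∈q (≢-sym q≢p) (≢-sym q≢p′))

module K2∪K3-in-CCG {n k : ℕ} (G : Graph n) (π : Partition n k) (deg≤3 : ∀ v → degree G v ≤ 3)
  {φ : Fin 5 → Fin k} (φ-injective : Injective _≡_ _≡_ φ)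
  (edge : ∀ a b → (a , b) ∈ edges K2∪K3 → CCGAdj G π (φ a) (φ b)) where

  open Graphs G
  open MaxDegree3 G deg≤3
  open Coalitions G π
  open Embedding φ-injective

  A B : VSet n
  A = V 0F
  B = V 1F

  triangle : Fin 3 → Fin 5
  triangle l = suc (suc l)

  T : Fin 3 → VSet n
  T l = V (triangle l)

  AB : CCGAdj G π (φ 0F) (φ 1F)
  AB = edge 0F 1F (here refl)
  T₀T₁ : CCGAdj G π (φ 2F) (φ 3F)
  T₀T₁ = edge 2F 3F (there (here refl))
  T₁T₂ : CCGAdj G π (φ 3F) (φ 4F)
  T₁T₂ = edge 3F 4F (there (there (here refl)))
  T₀T₂ : CCGAdj G π (φ 2F) (φ 4F)
  T₀T₂ = edge 2F 4F (there (there (there (here refl))))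

  T-pair-total : ∀ {l m} → l ≢ m → ∀ v → NeighbourIn (T l) v ⊎ NeighbourIn (T m) v
  T-pair-total {0F} {1F} _ v = neighbourIn-∪ (coalition-total T₀T₁ v)
  T-pair-total {1F} {2F} _ v = neighbourIn-∪ (coalition-total T₁T₂ v)
  T-pair-total {0F} {2F} _ v = neighbourIn-∪ (coalition-total T₀T₂ v)
  T-pair-total {1F} {0F} _ v = swap (neighbourIn-∪ (coalition-total T₀T₁ v))
  T-pair-total {2F} {1F} _ v = swap (neighbourIn-∪ (coalition-total T₁T₂ v))
  T-pair-total {2F} {0F} _ v = swap (neighbourIn-∪ (coalition-total T₀T₂ v))
  T-pair-total {0F} {0F} l≢l = ⊥-elim (l≢l refl)
  T-pair-total {1F} {1F} l≢l = ⊥-elim (l≢l refl)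
  T-pair-total {2F} {2F} l≢l = ⊥-elim (l≢l refl)

  T-not-cds : ∀ l → ¬ ConnectedDominating G (T l)
  T-not-cds 0F = coalition-not-cds₁ T₀T₁
  T-not-cds 1F = coalition-not-cds₁ T₁T₂
  T-not-cds 2F = coalition-not-cds₂ T₀T₂

  T-apart : ∀ {l m a b} → T l a → T m b → l ≢ m → a ≢ b
  T-apart a∈ b∈ l≢m = V-apart a∈ b∈ λ { refl → l≢m refl }

  T-∉-AB : ∀ {l a} → T l a → ¬ (A ∪ B) a
  T-∉-AB a∈T a∈AB = V∪-apart a∈AB a∈T (λ ()) (λ ()) refl

  AB-leaf-if-two-T-neighbours : ∀ {v l m} → NeighbourIn (T l) v → NeighbourIn (T m) v → l ≢ m →
    LeafIn (A ∪ B) v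
  AB-leaf-if-two-T-neighbours (u₁ , u₁∈ , v~u₁) (u₂ , u₂∈ , v~u₂) l≢m =
    leaf-if-two-outside v~u₁ v~u₂ (T-apart u₁∈ u₂∈ l≢m) (T-∉-AB u₁∈) (T-∉-AB u₂∈)

  AB-leaf : ∀ v → LeafIn (A ∪ B) v
  AB-leaf v with T-pair-total {0F} {1F} (λ ()) v | T-pair-total {1F} {2F} (λ ()) v
               | T-pair-total {0F} {2F} (λ ()) v
  ... | inj₁ n₀ | inj₁ n₁ | _       = AB-leaf-if-two-T-neighbours n₀ n₁ (λ ())
  ... | inj₁ n₀ | inj₂ n₂ | _       = AB-leaf-if-two-T-neighbours n₀ n₂ (λ ())
  ... | inj₂ n₁ | _       | inj₁ n₀ = AB-leaf-if-two-T-neighbours n₁ n₀ (λ ())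
  ... | inj₂ n₁ | _       | inj₂ n₂ = AB-leaf-if-two-T-neighbours n₁ n₂ (λ ())

  module _ {x y : Fin n} (x∈ : (A ∪ B) x) (y∈ : (A ∪ B) y) (x~y : Adj G x y) where

    AB-is-xy : ∀ {v} → (A ∪ B) v → v ≡ x ⊎ v ≡ y
    AB-is-xy v∈ = leaf-edge-component (AB-leaf x) (AB-leaf y) y∈ x~y (coalition-walk AB x∈ v∈)

    adjacent-to-x-or-y : ∀ v → Adj G v x ⊎ Adj G v y
    adjacent-to-x-or-y v with coalition-total AB v
    ... | u , u∈ , v~u with AB-is-xy u∈
    ...   | inj₁ refl = inj₁ v~u
    ...   | inj₂ refl = inj₂ v~u

    module _ {l m r : Fin 3} (l≢m : l ≢ m) (l≢r : l ≢ r) (m≢r : m ≢ r) {x′ y′ : Fin n}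
             (x′∈ : T l x′) (y′∈ : T l y′) (x~x′ : Adj G x x′) (y~y′ : Adj G y y′) where

      X : VSet n
      X = T l

      Other : VSet n
      Other v = ¬ (A ∪ B) v × v ≢ x′ × v ≢ y′

      T-other : ∀ {j v} → T j v → l ≢ j → Other v
      T-other v∈ l≢j = T-∉-AB v∈ , ≢-sym (T-apart x′∈ v∈ l≢j) , ≢-sym (T-apart y′∈ v∈ l≢j)

      x-leaf : LeafIn Other x
      x-leaf = leaf-if-two-outside x~y x~x′ (λ { refl → T-∉-AB x′∈ y∈ })
                 (λ y-other → proj₁ y-other y∈) (λ x′-other → proj₁ (proj₂ x′-other) refl)

      y-leaf : LeafIn Other y
      y-leaf = leaf-if-two-outside (Adj-sym x~y) y~y′ (λ { refl → T-∉-AB y′∈ x∈ })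
                 (λ x-other → proj₁ x-other x∈) (λ y′-other → proj₂ (proj₂ y′-other) refl)

      at-most-two-others : ∀ {p q s} → Other p → Other q → Other s → p ≢ q → p ≢ s → q ≢ s → ⊥
      at-most-two-others {p} {q} {s} p∈ q∈ s∈ p≢q p≢s q≢s
        with adjacent-to-x-or-y p | adjacent-to-x-or-y q | adjacent-to-x-or-y s
      ... | inj₁ p~x | inj₁ q~x | _        = p≢q (x-leaf p∈ q∈ (Adj-sym p~x) (Adj-sym q~x))
      ... | inj₂ p~y | inj₂ q~y | _        = p≢q (y-leaf p∈ q∈ (Adj-sym p~y) (Adj-sym q~y))
      ... | inj₁ p~x | inj₂ _   | inj₁ s~x = p≢s (x-leaf p∈ s∈ (Adj-sym p~x) (Adj-sym s~x))
      ... | inj₁ _   | inj₂ q~y | inj₂ s~y = q≢s (y-leaf q∈ s∈ (Adj-sym q~y) (Adj-sym s~y))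
      ... | inj₂ p~y | inj₁ _   | inj₂ s~y = p≢s (y-leaf p∈ s∈ (Adj-sym p~y) (Adj-sym s~y))
      ... | inj₂ _   | inj₁ q~x | inj₁ s~x = q≢s (x-leaf q∈ s∈ (Adj-sym q~x) (Adj-sym s~x))

      X-is-x′y′ : ∀ {u} → X u → u ≡ x′ ⊎ u ≡ y′
      X-is-x′y′ {u} u∈ with u ≟ x′ | u ≟ y′
      ... | yes u≡x′ | _        = inj₁ u≡x′
      ... | no _     | yes u≡y′ = inj₂ u≡y′
      ... | no u≢x′  | no u≢y′  = ⊥-elim (at-most-two-others (T-∉-AB u∈ , u≢x′ , u≢y′)
              (T-other v∈ l≢m) (T-other w∈ l≢r) (T-apart u∈ v∈ l≢m) (T-apart u∈ w∈ l≢r)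
              (T-apart v∈ w∈ m≢r))
        where
        v∈ = proj₂ (nonempty π (φ (triangle m)))
        w∈ = proj₂ (nonempty π (φ (triangle r)))

      X-dominating : Dominating G X
      X-dominating v v∉X with (part? (φ 0F) ∪? part? (φ 1F)) v
      ... | yes v∈AB with AB-is-xy v∈AB
      ...   | inj₁ refl = x′ , x′∈ , x~x′
      ...   | inj₂ refl = y′ , y′∈ , y~y′
      X-dominating v v∉X | no v∉AB with T-pair-total l≢m v | T-pair-total l≢r v
      ... | inj₁ nbr | _        = nbr
      ... | _        | inj₁ nbr = nbr
      ... | inj₂ (a , a∈ , v~a) | inj₂ (b , b∈ , v~b) = ⊥-elim (at-most-two-others
              (v∉AB , (λ { refl → v∉X x′∈ }) , (λ { refl → v∉X y′∈ }))
              (T-other a∈ l≢m) (T-other b∈ l≢r) (Adj⇒≢ v~a) (Adj⇒≢ v~b) (T-apart a∈ b∈ m≢r))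

      x′≢y′ : x′ ≢ y′
      x′≢y′ refl = Adj⇒≢ x~y (AB-leaf x′ x∈ y∈ (Adj-sym x~x′) (Adj-sym y~y′))

      no-common-neighbour : ∀ {a} → Adj G a x′ → Adj G a y′ → ⊥
      no-common-neighbour {a} a~x′ a~y′ with coalition-total AB a | T-pair-total m≢r a
      ... | e , e∈ , a~e | inj₁ (f , f∈ , a~f) = no-four-neighbours a~x′ a~y′ a~e a~f x′≢y′
              (λ { refl → T-∉-AB x′∈ e∈ }) (T-apart x′∈ f∈ l≢m) (λ { refl → T-∉-AB y′∈ e∈ })
              (T-apart y′∈ f∈ l≢m) (λ { refl → T-∉-AB f∈ e∈ })
      ... | e , e∈ , a~e | inj₂ (f , f∈ , a~f) = no-four-neighbours a~x′ a~y′ a~e a~f x′≢y′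
              (λ { refl → T-∉-AB x′∈ e∈ }) (T-apart x′∈ f∈ l≢r) (λ { refl → T-∉-AB y′∈ e∈ })
              (T-apart y′∈ f∈ l≢r) (λ { refl → T-∉-AB f∈ e∈ })

      T-neighbour-if-x′≁y′ : ¬ Adj G x′ y′ → ∀ {e j} → X e → l ≢ j → NeighbourIn (T j) e
      T-neighbour-if-x′≁y′ x′≁y′ {e} e∈ l≢j with T-pair-total l≢j e
      ... | inj₂ nbr = nbr
      ... | inj₁ (u , u∈ , e~u) with X-is-x′y′ e∈ | X-is-x′y′ u∈
      ...   | inj₁ refl | inj₁ refl = ⊥-elim (Adj⇒≢ e~u refl)
      ...   | inj₂ refl | inj₂ refl = ⊥-elim (Adj⇒≢ e~u refl)
      ...   | inj₁ refl | inj₂ refl = ⊥-elim (x′≁y′ e~u)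
      ...   | inj₂ refl | inj₁ refl = ⊥-elim (x′≁y′ (Adj-sym e~u))

      x′~y′ : Adj G x′ y′
      x′~y′ with adj G x′ y′ Bool.≟ true
      ... | yes x′~y′ = x′~y′
      ... | no x′≁y′
        with T-neighbour-if-x′≁y′ x′≁y′ x′∈ l≢m | T-neighbour-if-x′≁y′ x′≁y′ y′∈ l≢m
           | T-neighbour-if-x′≁y′ x′≁y′ x′∈ l≢r
      ...   | a , a∈ , x′~a | c , c∈ , y′~c | b , b∈ , x′~b with a ≟ c
      ...     | yes refl = ⊥-elim (no-common-neighbour (Adj-sym x′~a) (Adj-sym y′~c))
      ...     | no a≢c   = ⊥-elim (at-most-two-others (T-other a∈ l≢m) (T-other c∈ l≢m)
                             (T-other b∈ l≢r) a≢c (T-apart a∈ b∈ m≢r) (T-apart c∈ b∈ m≢r))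

      X-cds : ConnectedDominating G X
      X-cds = X-dominating , (x′ , x′∈) , X-walk
        where
        X-walk : ∀ u v → X u → X v → Walk G X u v
        X-walk u v u∈ v∈ with X-is-x′y′ u∈ | X-is-x′y′ v∈
        ... | inj₁ refl | inj₁ refl = here u∈
        ... | inj₂ refl | inj₂ refl = here u∈
        ... | inj₁ refl | inj₂ refl = step u∈ x′~y′ (here v∈)
        ... | inj₂ refl | inj₁ refl = step u∈ (Adj-sym x′~y′) (here v∈)

    shared-T-part : ∃ λ l → NeighbourIn (T l) x × NeighbourIn (T l) y
    shared-T-part with T-pair-total {0F} {1F} (λ ()) x | T-pair-total {0F} {1F} (λ ()) y
    ... | inj₁ nx₀ | inj₁ ny₀ = 0F , nx₀ , ny₀
    ... | inj₂ nx₁ | inj₂ ny₁ = 1F , nx₁ , ny₁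
    ... | inj₁ nx₀ | inj₂ ny₁
      with T-pair-total {1F} {2F} (λ ()) x | T-pair-total {0F} {2F} (λ ()) y
    ...   | inj₁ nx₁ | _        = 1F , nx₁ , ny₁
    ...   | inj₂ _   | inj₁ ny₀ = 0F , nx₀ , ny₀
    ...   | inj₂ nx₂ | inj₂ ny₂ = 2F , nx₂ , ny₂
    shared-T-part | inj₂ nx₁ | inj₁ ny₀
      with T-pair-total {1F} {2F} (λ ()) y | T-pair-total {0F} {2F} (λ ()) x
    ...   | inj₁ ny₁ | _        = 1F , nx₁ , ny₁
    ...   | inj₂ _   | inj₁ nx₀ = 0F , nx₀ , ny₀
    ...   | inj₂ ny₂ | inj₂ nx₂ = 2F , nx₂ , ny₂

    shared-T-part-cds : ∀ l → NeighbourIn (T l) x → NeighbourIn (T l) y →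
      ConnectedDominating G (T l)
    shared-T-part-cds 0F (_ , x′∈ , x~x′) (_ , y′∈ , y~y′) =
      X-cds {m = 1F} {r = 2F} (λ ()) (λ ()) (λ ()) x′∈ y′∈ x~x′ y~y′
    shared-T-part-cds 1F (_ , x′∈ , x~x′) (_ , y′∈ , y~y′) =
      X-cds {m = 0F} {r = 2F} (λ ()) (λ ()) (λ ()) x′∈ y′∈ x~x′ y~y′
    shared-T-part-cds 2F (_ , x′∈ , x~x′) (_ , y′∈ , y~y′) =
      X-cds {m = 0F} {r = 1F} (λ ()) (λ ()) (λ ()) x′∈ y′∈ x~x′ y~y′

  absurd : ⊥
  absurd with nonempty π (φ 0F)
  ... | x , x∈A with coalition-total AB x
  ...   | y , y∈ , x~y with shared-T-part (inj₁ x∈A) y∈ x~y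
  ...     | l , nx , ny = T-not-cds l (shared-T-part-cds (inj₁ x∈A) y∈ x~y l nx ny)

module K2∪S4-in-CCG {n k : ℕ} (G : Graph n) (π : Partition n k) (deg≤3 : ∀ v → degree G v ≤ 3)
  {φ : Fin 6 → Fin k} (φ-injective : Injective _≡_ _≡_ φ)
  (edge : ∀ a b → (a , b) ∈ edges K2∪S4 → CCGAdj G π (φ a) (φ b)) where

  open Graphs G
  open MaxDegree3 G deg≤3
  open Coalitions G π
  open Embedding φ-injective

  A B C : VSet n
  A = V 0F
  B = V 1F
  C = V 2F

  star-leaf : Fin 3 → Fin 6
  star-leaf i = suc (suc (suc i))

  L : Fin 3 → VSet n
  L i = V (star-leaf i)

  AB : CCGAdj G π (φ 0F) (φ 1F)
  AB = edge 0F 1F (here refl)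

  CL : ∀ i → CCGAdj G π (φ 2F) (φ (star-leaf i))
  CL 0F = edge 2F 3F (there (here refl))
  CL 1F = edge 2F 4F (there (there (here refl)))
  CL 2F = edge 2F 5F (there (there (there (here refl))))

  L-apart : ∀ {i j a b} → L i a → L j b → i ≢ j → a ≢ b
  L-apart a∈ b∈ i≢j = V-apart a∈ b∈ λ { refl → i≢j refl }

  AB-apart-L : ∀ {i a b} → (A ∪ B) a → L i b → a ≢ b
  AB-apart-L a∈ b∈ = V∪-apart a∈ b∈ (λ ()) (λ ())

  C-apart-L : ∀ {i a b} → C a → L i b → a ≢ b
  C-apart-L a∈ b∈ = V-apart a∈ b∈ (λ ())

  AB-∉-C : ∀ {a} → (A ∪ B) a → ¬ C a
  AB-∉-C a∈AB a∈C = V∪-apart a∈AB a∈C (λ ()) (λ ()) refl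

  AB-total : ∀ v → NeighbourIn (A ∪ B) v
  AB-total = coalition-total AB

  C-or-L : ∀ i v → NeighbourIn C v ⊎ NeighbourIn (L i) v
  C-or-L i v = neighbourIn-∪ (coalition-total (CL i) v)

  not-all-star-leaves : ∀ {v} →
    NeighbourIn (L 0F) v → NeighbourIn (L 1F) v → NeighbourIn (L 2F) v → ⊥
  not-all-star-leaves {v} (d₀ , d₀∈ , v~d₀) (d₁ , d₁∈ , v~d₁) (d₂ , d₂∈ , v~d₂) with AB-total v
  ... | a , a∈AB , v~a = no-four-neighbours v~a v~d₀ v~d₁ v~d₂
          (AB-apart-L a∈AB d₀∈) (AB-apart-L a∈AB d₁∈) (AB-apart-L a∈AB d₂∈)
          (L-apart d₀∈ d₁∈ (λ ())) (L-apart d₀∈ d₂∈ (λ ())) (L-apart d₁∈ d₂∈ (λ ()))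

  C-total : ∀ v → NeighbourIn C v
  C-total v with C-or-L 0F v | C-or-L 1F v | C-or-L 2F v
  ... | inj₁ c  | _       | _       = c
  ... | _       | inj₁ c  | _       = c
  ... | _       | _       | inj₁ c  = c
  ... | inj₂ l₀ | inj₂ l₁ | inj₂ l₂ = ⊥-elim (not-all-star-leaves l₀ l₁ l₂)

  C-maxDegree2 : MaxDegree2In C
  C-maxDegree2 = maxDegree2-if-neighbour-outside (λ {v} _ → AB-total v) AB-∉-C

  star-leaf-neighbour⇒C-leaf : ∀ {i p} → NeighbourIn (L i) p → LeafIn C p
  star-leaf-neighbour⇒C-leaf {p = p} (d , d∈L , p~d) with AB-total p
  ... | a , a∈AB , p~a = leaf-if-two-outside p~a p~d (AB-apart-L a∈AB d∈L) (AB-∉-C a∈AB)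
                           (λ d∈C → C-apart-L d∈C d∈L refl)

  two-star-leaves⇒no-C-neighbour : ∀ {i j p} →
    NeighbourIn (L i) p → NeighbourIn (L j) p → i ≢ j → ¬ NeighbourIn C p
  two-star-leaves⇒no-C-neighbour {p = p} (d , d∈ , p~d) (e , e∈ , p~e) i≢j (c , c∈C , p~c)
    with AB-total p
  ... | a , a∈AB , p~a = no-four-neighbours p~a p~d p~e p~c
          (AB-apart-L a∈AB d∈) (AB-apart-L a∈AB e∈) (∉⇒≢ (AB-∉-C a∈AB) c∈C)
          (L-apart d∈ e∈ i≢j) (≢-sym (C-apart-L c∈C d∈)) (≢-sym (C-apart-L c∈C e∈))

  no-three-exits : ∀ {u} → Exit C (L 0F) u → Exit C (L 1F) u → Exit C (L 2F) u → ⊥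
  no-three-exits (p₀ , u⇝p₀ , n₀) (p₁ , u⇝p₁ , n₁) (p₂ , u⇝p₂ , n₂) =
    no-three-leaves C-maxDegree2
      (star-leaf-neighbour⇒C-leaf n₀) (star-leaf-neighbour⇒C-leaf n₁)
      (star-leaf-neighbour⇒C-leaf n₂)
      p₀≢p₁ p₀≢p₂ p₁≢p₂ (reverse u⇝p₀ ◅◅ u⇝p₁) (reverse u⇝p₀ ◅◅ u⇝p₂)
    where
    p₀≢p₁ : p₀ ≢ p₁
    p₀≢p₁ refl = not-all-star-leaves n₀ n₁ (subst (NeighbourIn (L 2F))
      (isolated-walk (two-star-leaves⇒no-C-neighbour n₀ n₁ (λ ())) (reverse u⇝p₀ ◅◅ u⇝p₂)) n₂)
    p₀≢p₂ : p₀ ≢ p₂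
    p₀≢p₂ refl = not-all-star-leaves n₀ (subst (NeighbourIn (L 1F))
      (isolated-walk (two-star-leaves⇒no-C-neighbour n₀ n₂ (λ ())) (reverse u⇝p₀ ◅◅ u⇝p₁)) n₁) n₂
    p₁≢p₂ : p₁ ≢ p₂
    p₁≢p₂ refl = not-all-star-leaves (subst (NeighbourIn (L 0F))
      (isolated-walk (two-star-leaves⇒no-C-neighbour n₁ n₂ (λ ())) (reverse u⇝p₁ ◅◅ u⇝p₀)) n₀) n₁ n₂

  C-connected : InducedConnected G C
  C-connected = nonempty π (φ 2F) , walk
    where
    walk-or-exit-towards : ∀ i {u v} → C u → C v → Walk G C u v ⊎ Exit C (L i) u
    walk-or-exit-towards i u∈C v∈C =
      walk-or-exit (part? (φ 2F)) (coalition-walk (CL i) (inj₁ u∈C) (inj₁ v∈C)) u∈C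
    walk : ∀ u v → C u → C v → Walk G C u v
    walk u v u∈C v∈C
      with walk-or-exit-towards 0F u∈C v∈C | walk-or-exit-towards 1F u∈C v∈C
         | walk-or-exit-towards 2F u∈C v∈C
    ... | inj₁ wk | _       | _       = wk
    ... | _       | inj₁ wk | _       = wk
    ... | _       | _       | inj₁ wk = wk
    ... | inj₂ x₀ | inj₂ x₁ | inj₂ x₂ = ⊥-elim (no-three-exits x₀ x₁ x₂)

  absurd : ⊥
  absurd = coalition-not-cds₁ (CL 0F) ((λ v _ → C-total v) , C-connected)

module 2C3+e-in-CCG {n k : ℕ} (G : Graph n) (π : Partition n k) (deg≤3 : ∀ v → degree G v ≤ 3)
  {φ : Fin 5 → Fin k} (φ-injective : Injective _≡_ _≡_ φ)
  (edge : ∀ a b → (a , b) ∈ edges 2C3+e → CCGAdj G π (φ a) (φ b)) where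

  open Graphs G
  open MaxDegree3 G deg≤3
  open Coalitions G π
  open Embedding φ-injective

  A B C D E : VSet n
  A = V 0F
  B = V 1F
  C = V 2F
  D = V 3F
  E = V 4F

  AB : CCGAdj G π (φ 0F) (φ 1F)
  AB = edge 0F 1F (here refl)
  AC : CCGAdj G π (φ 0F) (φ 2F)
  AC = edge 0F 2F (there (here refl))
  AD : CCGAdj G π (φ 0F) (φ 3F)
  AD = edge 0F 3F (there (there (here refl)))
  BC : CCGAdj G π (φ 1F) (φ 2F)
  BC = edge 1F 2F (there (there (there (here refl))))
  BD : CCGAdj G π (φ 1F) (φ 3F)
  BD = edge 1F 3F (there (there (there (there (here refl)))))
  AE : CCGAdj G π (φ 0F) (φ 4F)
  AE = edge 0F 4F (there (there (there (there (there (here refl))))))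

  A-total : ∀ v → NeighbourIn A v
  A-total v with neighbourIn-∪ (coalition-total AB v) | neighbourIn-∪ (coalition-total AC v)
               | neighbourIn-∪ (coalition-total AD v) | neighbourIn-∪ (coalition-total AE v)
  ... | inj₁ a | _      | _      | _      = a
  ... | _      | inj₁ a | _      | _      = a
  ... | _      | _      | inj₁ a | _      = a
  ... | _      | _      | _      | inj₁ a = a
  ... | inj₂ (b , b∈ , v~b) | inj₂ (c , c∈ , v~c) | inj₂ (d , d∈ , v~d) | inj₂ (e , e∈ , v~e) =
    ⊥-elim (no-four-neighbours v~b v~c v~d v~e (V-apart b∈ c∈ (λ ())) (V-apart b∈ d∈ (λ ()))
      (V-apart b∈ e∈ (λ ())) (V-apart c∈ d∈ (λ ())) (V-apart c∈ e∈ (λ ())) (V-apart d∈ e∈ (λ ())))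

  BC-total : ∀ v → NeighbourIn (B ∪ C) v
  BC-total = coalition-total BC

  BD-total : ∀ v → NeighbourIn (B ∪ D) v
  BD-total = coalition-total BD

  no-D-and-E-neighbours : ∀ {v} → NeighbourIn D v → NeighbourIn E v → ⊥
  no-D-and-E-neighbours {v} (d , d∈ , v~d) (e , e∈ , v~e) with A-total v | BC-total v
  ... | a , a∈ , v~a | s , s∈ , v~s = no-four-neighbours v~a v~d v~e v~s
          (V-apart a∈ d∈ (λ ())) (V-apart a∈ e∈ (λ ())) (V-apart-∪ a∈ s∈ (λ ()) (λ ()))
          (V-apart d∈ e∈ (λ ())) (V-apart-∪ d∈ s∈ (λ ()) (λ ())) (V-apart-∪ e∈ s∈ (λ ()) (λ ()))

  no-C-and-E-neighbours : ∀ {v} → NeighbourIn C v → NeighbourIn E v → ⊥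
  no-C-and-E-neighbours {v} (c , c∈ , v~c) (e , e∈ , v~e) with A-total v | BD-total v
  ... | a , a∈ , v~a | s , s∈ , v~s = no-four-neighbours v~a v~c v~e v~s
          (V-apart a∈ c∈ (λ ())) (V-apart a∈ e∈ (λ ())) (V-apart-∪ a∈ s∈ (λ ()) (λ ()))
          (V-apart c∈ e∈ (λ ())) (V-apart-∪ c∈ s∈ (λ ()) (λ ())) (V-apart-∪ e∈ s∈ (λ ()) (λ ()))

  no-two-A-and-E-neighbours : ∀ {v x y} → A x → A y → x ≢ y → Adj G v x → Adj G v y →
    NeighbourIn E v → ⊥
  no-two-A-and-E-neighbours {v} x∈ y∈ x≢y v~x v~y (e , e∈ , v~e) with BC-total v
  ... | s , s∈ , v~s = no-four-neighbours v~x v~y v~e v~s x≢y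
          (V-apart x∈ e∈ (λ ())) (V-apart-∪ x∈ s∈ (λ ()) (λ ()))
          (V-apart y∈ e∈ (λ ())) (V-apart-∪ y∈ s∈ (λ ()) (λ ())) (V-apart-∪ e∈ s∈ (λ ()) (λ ()))

  A-∉-B∪ : ∀ {j a} → A a → ¬ (B ∪ V (suc (suc j))) a
  A-∉-B∪ a∈A a∈B∪ = V∪-apart a∈B∪ a∈A (λ ()) (λ ()) refl

  C-leaf : ∀ v → LeafIn C v
  C-leaf v with A-total v | BD-total v
  ... | a , a∈ , v~a | s , s∈ , v~s = leaf-if-two-outside v~a v~s (V-apart-∪ a∈ s∈ (λ ()) (λ ()))
          (V-∉ a∈ (λ ())) (λ s∈C → V∪-apart s∈ s∈C (λ ()) (λ ()) refl)

  B∪-leaf : ∀ {j l v o} → V l o → Adj G v o → 0F ≢ l → 1F ≢ l → suc (suc j) ≢ l →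
    LeafIn (B ∪ V (suc (suc j))) v
  B∪-leaf {v = v} o∈ v~o 0≢l 1≢l j≢l with A-total v
  ... | a , a∈ , v~a = leaf-if-two-outside v~a v~o (V-apart a∈ o∈ 0≢l) (A-∉-B∪ a∈)
                         (λ o∈B∪ → V∪-apart o∈B∪ o∈ 1≢l j≢l refl)

  BC-maxDegree2 : MaxDegree2In (B ∪ C)
  BC-maxDegree2 = maxDegree2-if-neighbour-outside (λ {v} _ → A-total v) A-∉-B∪

  BD-maxDegree2 : MaxDegree2In (B ∪ D)
  BD-maxDegree2 = maxDegree2-if-neighbour-outside (λ {v} _ → A-total v) A-∉-B∪

  BD-edge : ∃₂ λ t d → B t × D d × Adj G t d
  BD-edge = crossing-edge (part? (φ 1F)) (coalition-walk BD (inj₁ b∈) (inj₂ d∈)) b∈ (V-∉ d∈ (λ ()))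
    where
    b∈ = proj₂ (nonempty π (φ 1F))
    d∈ = proj₂ (nonempty π (φ 3F))

  module _ {t d z s₂ s₃ : Fin n} (t∈B : B t) (d∈D : D d) (t~d : Adj G t d) (z∈E : E z)
           (s₂∈BC : (B ∪ C) s₂) (z~s₂ : Adj G z s₂) (s₃∈BD : (B ∪ D) s₃) (z~s₃ : Adj G z s₃) where

    BC-leaf-in-C⇒s₂ : ∀ {w} → C w → LeafIn (B ∪ C) w → w ≡ s₂
    BC-leaf-in-C⇒s₂ {w} w∈C w-leaf with w ≟ s₂
    ... | yes w≡s₂ = w≡s₂
    ... | no w≢s₂  = ⊥-elim (no-three-leaves BC-maxDegree2
          (B∪-leaf d∈D t~d (λ ()) (λ ()) (λ ())) w-leaf
          (B∪-leaf z∈E (Adj-sym z~s₂) (λ ()) (λ ()) (λ ()))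
          (V-apart t∈B w∈C (λ ())) t≢s₂ w≢s₂
          (coalition-walk BC (inj₁ t∈B) (inj₂ w∈C)) (coalition-walk BC (inj₁ t∈B) s₂∈BC))
      where
      t≢s₂ : t ≢ s₂
      t≢s₂ refl = no-D-and-E-neighbours (d , d∈D , t~d) (z , z∈E , Adj-sym z~s₂)

    C-vertex-with-two-A-neighbours : ∀ {x y w} → A x → A y → x ≢ y → C w →
      Adj G w x → Adj G w y → ⊥
    C-vertex-with-two-A-neighbours x∈ y∈ x≢y w∈C w~x w~y
      with BC-leaf-in-C⇒s₂ w∈C (leaf-if-two-outside w~x w~y x≢y (A-∉-B∪ x∈) (A-∉-B∪ y∈))
    ... | refl = no-two-A-and-E-neighbours x∈ y∈ x≢y w~x w~y (z , z∈E , Adj-sym z~s₂)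

    C-vertex-with-A-and-D-neighbours : ∀ {x w} → A x → C w → Adj G w x → NeighbourIn D w → ⊥
    C-vertex-with-A-and-D-neighbours x∈ w∈C w~x (d′ , d′∈ , w~d′)
      with BC-leaf-in-C⇒s₂ w∈C (leaf-if-two-outside w~x w~d′ (V-apart x∈ d′∈ (λ ())) (A-∉-B∪ x∈)
                                   (λ d′∈BC → V∪-apart d′∈BC d′∈ (λ ()) (λ ()) refl))
    ... | refl = no-D-and-E-neighbours (d′ , d′∈ , w~d′) (z , z∈E , Adj-sym z~s₂)

    distinct-B-neighbours : ∀ {b₁ b₂ w₁ w₂} → B b₁ → B b₂ → b₁ ≢ b₂ → C w₁ → C w₂ →
      Adj G b₁ w₁ → Adj G b₂ w₂ → ⊥
    distinct-B-neighbours b₁∈ b₂∈ b₁≢b₂ w₁∈ w₂∈ b₁~w₁ b₂~w₂ = no-three-leaves BD-maxDegree2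
      (B∪-leaf w₁∈ b₁~w₁ (λ ()) (λ ()) (λ ())) (B∪-leaf w₂∈ b₂~w₂ (λ ()) (λ ()) (λ ()))
      (B∪-leaf z∈E (Adj-sym z~s₃) (λ ()) (λ ()) (λ ()))
      b₁≢b₂ (≢s₃ w₁∈ b₁~w₁) (≢s₃ w₂∈ b₂~w₂)
      (coalition-walk BD (inj₁ b₁∈) (inj₁ b₂∈)) (coalition-walk BD (inj₁ b₁∈) s₃∈BD)
      where
      ≢s₃ : ∀ {b w} → C w → Adj G b w → b ≢ s₃
      ≢s₃ w∈ b~w refl = no-C-and-E-neighbours (_ , w∈ , b~w) (z , z∈E , Adj-sym z~s₃)

    common-B-neighbour : ∀ {b w₁ w₂} → B b → C w₁ → C w₂ → Adj G w₁ w₂ →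
      Adj G b w₁ → Adj G b w₂ → ⊥
    common-B-neighbour {b} b∈ w₁∈ w₂∈ w₁~w₂ b~w₁ b~w₂
      with triangle-component BC-maxDegree2 (inj₁ b∈) (inj₂ w₁∈) (inj₂ w₂∈) b~w₁ w₁~w₂ b~w₂
             (coalition-walk BC (inj₁ b∈) (inj₁ t∈B))
    ... | inj₂ (inj₁ t≡w₁) = V-apart t∈B w₁∈ (λ ()) t≡w₁
    ... | inj₂ (inj₂ t≡w₂) = V-apart t∈B w₂∈ (λ ()) t≡w₂
    ... | inj₁ refl with A-total b
    ...   | a , a∈ , b~a = no-four-neighbours b~a b~w₁ b~w₂ t~d
            (V-apart a∈ w₁∈ (λ ())) (V-apart a∈ w₂∈ (λ ())) (V-apart a∈ d∈D (λ ()))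
            (Adj⇒≢ w₁~w₂) (V-apart w₁∈ d∈D (λ ())) (V-apart w₂∈ d∈D (λ ()))

    no-A-C-C-A-path : ∀ {x y w₁ w₂} → A x → A y → C w₁ → C w₂ →
      Adj G x w₁ → Adj G w₁ w₂ → Adj G w₂ y → ⊥
    no-A-C-C-A-path {w₁ = w₁} {w₂} x∈ y∈ w₁∈ w₂∈ x~w₁ w₁~w₂ w₂~y with BD-total w₁ | BD-total w₂
    ... | d₁ , inj₂ d₁∈ , w₁~d₁ | _ =
      C-vertex-with-A-and-D-neighbours x∈ w₁∈ (Adj-sym x~w₁) (d₁ , d₁∈ , w₁~d₁)
    ... | _ | d₂ , inj₂ d₂∈ , w₂~d₂ =
      C-vertex-with-A-and-D-neighbours y∈ w₂∈ w₂~y (d₂ , d₂∈ , w₂~d₂)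
    ... | b₁ , inj₁ b₁∈ , w₁~b₁ | b₂ , inj₁ b₂∈ , w₂~b₂ with b₁ ≟ b₂
    ...   | yes refl = common-B-neighbour b₁∈ w₁∈ w₂∈ w₁~w₂ (Adj-sym w₁~b₁) (Adj-sym w₂~b₂)
    ...   | no b₁≢b₂ =
      distinct-B-neighbours b₁∈ b₂∈ b₁≢b₂ w₁∈ w₂∈ (Adj-sym w₁~b₁) (Adj-sym w₂~b₂)

    no-A-bridge : ∀ {x y} → A x → A y → x ≢ y → Bridge C x y → ⊥
    no-A-bridge x∈ y∈ x≢y (w , w′ , x~w , wk , w′~y) with w ≟ w′
    ... | yes refl = C-vertex-with-two-A-neighbours x∈ y∈ x≢y (start∈ wk) (Adj-sym x~w) w′~y
    ... | no w≢w′ with first-step wk w≢w′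
    ...   | w₂ , w₂∈ , w~w₂ with leaf-edge-component (C-leaf w) (C-leaf w₂) w₂∈ w~w₂ wk
    ...     | inj₁ w′≡w = w≢w′ (sym w′≡w)
    ...     | inj₂ refl = no-A-C-C-A-path x∈ y∈ (start∈ wk) w₂∈ x~w w~w₂ w′~y

    A-connected : InducedConnected G A
    A-connected = nonempty π (φ 0F) , λ u v u∈ v∈ →
      bridges-elim (part? (φ 0F)) join (coalition-walk AC (inj₁ u∈) (inj₁ v∈)) u∈ v∈
      where
      join : ∀ {x y} → A x → A y → Bridge C x y → Walk G A x y
      join {x} {y} x∈ y∈ bridge with x ≟ y
      ... | yes refl = here x∈
      ... | no x≢y   = ⊥-elim (no-A-bridge x∈ y∈ x≢y bridge)

  absurd : ⊥
  absurd with BD-edge | nonempty π (φ 4F)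
  ... | t , d , t∈B , d∈D , t~d | z , z∈E with BC-total z | BD-total z
  ...   | s₂ , s₂∈ , z~s₂ | s₃ , s₃∈ , z~s₃ = coalition-not-cds₁ AB
          ((λ v _ → A-total v) , A-connected t∈B d∈D t~d z∈E s₂∈ z~s₂ s₃∈ z~s₃)

lemma7 : ∀ {n k} (G : Graph n) (π : Partition n k) →
    Subcubic G → IsConnectedCoalitionPartition G π →
    ¬ ContainsSubgraph (CCGAdj G π) K2∪K3 ×
    ¬ ContainsSubgraph (CCGAdj G π) K2∪S4 ×
    ¬ ContainsSubgraph (CCGAdj G π) 2C3+e
lemma7 G π (_ , deg≤3) _ = no-K2∪K3 , no-K2∪S4 , no-2C3+e
  where
  no-K2∪K3 : ¬ ContainsSubgraph (CCGAdj G π) K2∪K3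
  no-K2∪K3 (_ , φ-injective , edge) = K2∪K3-in-CCG.absurd G π deg≤3 φ-injective edge

  no-K2∪S4 : ¬ ContainsSubgraph (CCGAdj G π) K2∪S4
  no-K2∪S4 (_ , φ-injective , edge) = K2∪S4-in-CCG.absurd G π deg≤3 φ-injective edge

  no-2C3+e : ¬ ContainsSubgraph (CCGAdj G π) 2C3+e
  no-2C3+e (_ , φ-injective , edge) = 2C3+e-in-CCG.absurd G π deg≤3 φ-injective edge
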